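{- If $X$ is a connected regular graph such that $\mathrm{Aut}(X)$ acts transitively on pairs of vertices at distance two, then either $X$ is a core or the core of $X$ is a complete graph.
   Context: A homomorphism $X\to Y$ is a map $V(X)\to V(Y)$ sending edges to edges; $X$ and $Y$ are homomorphically equivalent if there are homomorphisms in both directions. A graph is a core if every endomorphism (homomorphism to itself) is an automorphism. Every graph $X$ is homomorphically equivalent to a unique (up to isomorphism) core, called the core of $X$. -}

module Defs where

open import Data.Nat using (ℕ; zero; suc; _<_)
open import Data.Fin using (Fin; _≟_)
open import Data.Bool using (Bool; true; false; if_then_else_; not)
open import Data.List using (map; allFin)
open import Data.Nat.ListAction using (sum)
open import Data.Product using (Σ; _×_; _,_)
open import Data.Sum using (_⊎_)
open import Relation.Nullary using (¬_)
open import Relation.Nullary.Decidable using (⌊_⌋)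
open import Relation.Binary.PropositionalEquality using (_≡_; refl; sym)
open import Relation.Nullary using (yes; no)
open import Data.Empty using (⊥-elim)
open import Function.Definitions using (Bijective)

record Graph : Set where
  field
    n     : ℕ
    adj   : Fin n → Fin n → Bool
    adj-sym : ∀ u v → adj u v ≡ adj v u
    adj-irrefl : ∀ v → adj v v ≡ false

open Graph public

V : Graph → Set
V X = Fin (n X)

Adj : (X : Graph) → V X → V X → Set
Adj X u v = adj X u v ≡ true

data Walk (X : Graph) : V X → V X → ℕ → Set where
  here : ∀ {u} → Walk X u u zero
  step : ∀ {u w v k} → Adj X u w → Walk X w v k → Walk X u v (suc k)

Dist : (X : Graph) → V X → V X → ℕ → Set
Dist X u v d = Walk X u v d × (∀ k → k < d → ¬ Walk X u v k)

Connected : Graph → Set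
Connected X = ∀ (u v : V X) → Σ ℕ (λ k → Walk X u v k)

degree : (X : Graph) → V X → ℕ
degree X v = sum (map (λ w → if adj X v w then 1 else 0) (allFin (n X)))

Regular : Graph → Set
Regular X = Σ ℕ (λ k → ∀ v → degree X v ≡ k)

IsHom : (X Y : Graph) → (V X → V Y) → Set
IsHom X Y f = ∀ u v → Adj X u v → Adj Y (f u) (f v)

Hom : Graph → Graph → Set
Hom X Y = Σ (V X → V Y) (IsHom X Y)

HomEquiv : Graph → Graph → Set
HomEquiv X Y = Hom X Y × Hom Y X

IsIso : (X Y : Graph) → (V X → V Y) → Set
IsIso X Y f = Bijective _≡_ _≡_ f × (∀ u v → adj X u v ≡ adj Y (f u) (f v))

Isomorphic : Graph → Graph → Set
Isomorphic X Y = Σ (V X → V Y) (IsIso X Y)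

IsAutomorphism : (X : Graph) → (V X → V X) → Set
IsAutomorphism X = IsIso X X

IsCore : Graph → Set
IsCore X = ∀ (f : V X → V X) → IsHom X X f → IsAutomorphism X f

K : ℕ → Graph
K m = record
  { n = m
  ; adj = λ u v → not ⌊ u ≟ v ⌋
  ; adj-sym = symK
  ; adj-irrefl = irrK
  }
  where
  symK : ∀ (u v : Fin m) → not ⌊ u ≟ v ⌋ ≡ not ⌊ v ≟ u ⌋
  symK u v with u ≟ v | v ≟ u
  ... | yes _ | yes _ = refl
  ... | no _  | no _  = refl
  ... | yes p | no q  = ⊥-elim (q (sym p))
  ... | no p  | yes q = ⊥-elim (p (sym q))
  irrK : ∀ (v : Fin m) → not ⌊ v ≟ v ⌋ ≡ false
  irrK v with v ≟ v
  ... | yes _ = refl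
  ... | no p  = ⊥-elim (p refl)

IsComplete : Graph → Set
IsComplete Y = Σ ℕ (λ m → Isomorphic Y (K m))

DistTwoTransitive : Graph → Set
DistTwoTransitive X =
  ∀ (u v u' v' : V X) → Dist X u v 2 → Dist X u' v' 2 →
  Σ (V X → V X) (λ σ → IsAutomorphism X σ × (σ u ≡ u') × (σ v ≡ v'))

-- "The core of X is complete": every core homomorphically equivalent to X
-- (unique up to isomorphism) is isomorphic to a complete graph.
CoreIsComplete : Graph → Set
CoreIsComplete X = ∀ (Y : Graph) → IsCore Y → HomEquiv X Y → IsComplete Y

module Submission where

-- Call x and y "two apart" when they are distinct, non-adjacent and have a
-- common neighbour; these are exactly the pairs at distance two.  Since X is
-- finite, it is decidable whether some endomorphism of X identifies a
-- two-apart pair, and the proof splits on this.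
--
-- * If one does, distance-two transitivity lets us identify EVERY two-apart
--   pair of X by an endomorphism.  Transported to a core Y of X (through
--   Y → X → Y, which is an automorphism of Y), this shows that Y has no
--   two-apart pair.  Walks of the connected graph X map to walks of Y, and
--   a walk in a graph without two-apart pairs joins equal or adjacent
--   vertices; hence Y is complete.
-- * If none does, every endomorphism f is injective on neighbourhoods (and
--   adjacent vertices are never identified, X being loopless).  In a regular
--   graph, counting then makes f map neighbourhoods onto neighbourhoods, so
--   walks lift along f; connectivity makes f surjective, hence bijective on
--   the finite vertex set, and f reflects adjacency: X is a core.

open import Defs
open import Data.Bool using (Bool; true; false; if_then_else_; not)
open import Data.Bool.Properties using (⇔→≡) renaming (_≟_ to _≟ᵇ_)
open import Data.Empty using (⊥-elim)
open import Data.Fin using (Fin; zero; suc; punchOut; _≟_; finToFun; funToFin)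
open import Data.Fin.Properties
  using (any?; all?; injective⇒≤; punchOut-injective; finToFun-funToFin)
open import Data.List using (List; []; _∷_; map; length; lookup; filter; allFin)
open import Data.List.Properties using (length-map)
open import Data.List.Membership.Propositional using (_∈_)
open import Data.List.Membership.Propositional.Properties
  using (∈-lookup; ∈-map⁻; ∈-filter⁺; ∈-filter⁻; ∈-allFin)
open import Data.List.Relation.Binary.Subset.Propositional using (_⊆_)
open import Data.List.Relation.Unary.All as All using (All)
open import Data.List.Relation.Unary.All.Properties as All using ()
open import Data.List.Relation.Unary.AllPairs using ([]; _∷_)
open import Data.List.Relation.Unary.Any as Any using (here; there)
open import Data.List.Relation.Unary.Any.Properties using (lookup-index)
open import Data.List.Relation.Unary.Unique.Propositional using (Unique)
open import Data.List.Relation.Unary.Unique.Propositional.Properties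
  using (filter⁺; allFin⁺)
open import Data.Nat using (ℕ; zero; suc; _≤_; _<_; s≤s)
open import Data.Nat.ListAction using (sum)
open import Data.Nat.Properties using (≤-trans; ≤-reflexive; 1+n≰n; module ≤-Reasoning)
open import Data.Product using (∃; ∃₂; _×_; _,_; proj₁; proj₂)
open import Data.Sum using (_⊎_; inj₁; inj₂)
open import Function using (_∘_; id)
open import Function.Bundles using (mk⇔)
open import Function.Definitions using (Injective; StrictlySurjective)
open import Function.Consequences.Propositional using (strictlySurjective⇒surjective)
open import Relation.Nullary using (¬_; Dec; yes; no; contradiction)
open import Relation.Nullary.Decidable using (_×-dec_; _→-dec_; ¬?; ⌊_⌋)
open import Relation.Binary.PropositionalEquality
  using (_≡_; _≢_; _≗_; refl; sym; trans; cong; subst; subst₂; module ≡-Reasoning)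

private
  variable
    A B : Set
    m : ℕ

-- An injective endomap of a finite set is onto: a missed point z would let
-- us squeeze Fin (suc m) injectively into Fin m by punching out z.
injective⇒onto : {f : Fin m → Fin m} → Injective _≡_ _≡_ f → StrictlySurjective _≡_ f
injective⇒onto {suc m} {f} f-inj z with any? (λ i → f i ≟ z)
... | yes hit = hit
... | no miss = contradiction (injective⇒≤ punched-injective) 1+n≰n
  where
  missed : ∀ i → z ≢ f i
  missed i z≡fi = miss (i , sym z≡fi)

  punched : Fin (suc m) → Fin m
  punched i = punchOut (missed i)

  punched-injective : Injective _≡_ _≡_ punched
  punched-injective {x} {y} eq = f-inj (punchOut-injective {i = z} (missed x) (missed y) eq)

-- An onto endomap of a finite set is injective: a section r of f is
-- injective, hence onto, so every point is r of something.
onto⇒injective : {f : Fin m → Fin m} → StrictlySurjective _≡_ f → Injective _≡_ _≡_ f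
onto⇒injective {f = f} f-onto {a} {b} fa≡fb = begin
  a       ≡⟨ sym ra′≡a ⟩
  r a′    ≡⟨ cong r a′≡b′ ⟩
  r b′    ≡⟨ rb′≡b ⟩
  b       ∎
  where
  open ≡-Reasoning
  r : Fin _ → Fin _
  r z = proj₁ (f-onto z)

  fr : ∀ z → f (r z) ≡ z
  fr z = proj₂ (f-onto z)

  r-injective : Injective _≡_ _≡_ r
  r-injective {x} {y} rx≡ry = trans (sym (fr x)) (trans (cong f rx≡ry) (fr y))

  a′ = proj₁ (injective⇒onto r-injective a)
  ra′≡a = proj₂ (injective⇒onto r-injective a)
  b′ = proj₁ (injective⇒onto r-injective b)
  rb′≡b = proj₂ (injective⇒onto r-injective b)

  a′≡b′ : a′ ≡ b′
  a′≡b′ = begin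
    a′         ≡⟨ sym (fr a′) ⟩
    f (r a′)   ≡⟨ cong f ra′≡a ⟩
    f a        ≡⟨ fa≡fb ⟩
    f b        ≡⟨ cong f (sym rb′≡b) ⟩
    f (r b′)   ≡⟨ fr b′ ⟩
    b′         ∎

lookup-injective : {xs : List A} → Unique xs → Injective _≡_ _≡_ (lookup xs)
lookup-injective (x≢ ∷ u) {zero}  {zero}  _  = refl
lookup-injective (x≢ ∷ u) {zero}  {suc j} eq = contradiction eq (All.lookup x≢ (∈-lookup j))
lookup-injective (x≢ ∷ u) {suc i} {zero}  eq = contradiction (sym eq) (All.lookup x≢ (∈-lookup i))
lookup-injective (x≢ ∷ u) {suc i} {suc j} eq = cong suc (lookup-injective u eq)

-- Pigeonhole for lists: a duplicate-free list contained in ys is no longer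
-- than ys, since sending each entry to a position in ys is injective.
unique-⊆⇒length≤ : {xs ys : List A} → Unique xs → xs ⊆ ys → length xs ≤ length ys
unique-⊆⇒length≤ {xs = xs} {ys} xs-unique xs⊆ys = injective⇒≤ position-injective
  where
  position : Fin (length xs) → Fin (length ys)
  position i = Any.index (xs⊆ys (∈-lookup i))

  position-injective : Injective _≡_ _≡_ position
  position-injective {i} {j} eq = lookup-injective xs-unique (begin
    lookup xs i            ≡⟨ lookup-index (xs⊆ys (∈-lookup i)) ⟩
    lookup ys (position i) ≡⟨ cong (lookup ys) eq ⟩
    lookup ys (position j) ≡⟨ sym (lookup-index (xs⊆ys (∈-lookup j))) ⟩
    lookup xs j            ∎)
    where open ≡-Reasoning

unique-map : (f : A → B) {xs : List A} →
  (∀ {a b} → a ∈ xs → b ∈ xs → f a ≡ f b → a ≡ b) → Unique xs → Unique (map f xs)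
unique-map f inj [] = []
unique-map f inj (x≢ ∷ u) =
  All.map⁺ (All.tabulate λ y∈ fx≡fy → All.lookup x≢ y∈ (inj (here refl) (there y∈) fx≡fy))
  ∷ unique-map f (λ a∈ b∈ → inj (there a∈) (there b∈)) u

count≡length-filter : (p : A → Bool) (xs : List A) →
  sum (map (λ x → if p x then 1 else 0) xs) ≡ length (filter (λ x → p x ≟ᵇ true) xs)
count≡length-filter p [] = refl
count≡length-filter p (x ∷ xs) with p x
... | true  = cong suc (count≡length-filter p xs)
... | false = count≡length-filter p xs

-- Existence over the finite function space Fin m → Fin k is decidable for
-- predicates respecting pointwise equality: search through Fin (k ^ m).
∃-fun? : ∀ {k} (P : (Fin m → Fin k) → Set) →
  (∀ {f g} → f ≗ g → P f → P g) → (∀ f → Dec (P f)) → Dec (∃ P)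
∃-fun? P resp P? with any? (λ i → P? (finToFun i))
... | yes (i , p) = yes (finToFun i , p)
... | no none     = no λ (f , pf) → none (funToFin f , resp (sym ∘ finToFun-funToFin f) pf)

adj-swap : (X : Graph) {u v : V X} → Adj X u v → Adj X v u
adj-swap X {u} {v} uv = trans (adj-sym X v u) uv

-- Homomorphisms never identify adjacent vertices, as graphs are loopless.
hom-separates : (X Y : Graph) {f : V X → V Y} → IsHom X Y f →
  ∀ {u v} → Adj X u v → f u ≢ f v
hom-separates X Y {f} f-hom {u} uv fu≡fv =
  contradiction (trans (sym loop) (adj-irrefl Y (f u))) λ ()
  where
  loop : Adj Y (f u) (f u)
  loop = subst (Adj Y (f u)) (sym fu≡fv) (f-hom _ _ uv)

map-walk : (X Y : Graph) {f : V X → V Y} → IsHom X Y f →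
  ∀ {s t k} → Walk X s t k → Walk Y (f s) (f t) k
map-walk X Y f-hom here         = here
map-walk X Y f-hom (step sw wt) = step (f-hom _ _ sw) (map-walk X Y f-hom wt)

automorphism⇒hom : (X : Graph) {σ : V X → V X} → IsAutomorphism X σ → IsHom X X σ
automorphism⇒hom X (_ , σ-iso) u v uv = trans (sym (σ-iso u v)) uv

TwoApart : (X : Graph) → V X → V X → Set
TwoApart X x y = x ≢ y × ¬ Adj X x y × ∃ λ w → Adj X x w × Adj X w y

twoApart⇒dist2 : (X : Graph) {x y : V X} → TwoApart X x y → Dist X x y 2
twoApart⇒dist2 X (x≢y , x≁y , w , xw , wy) = step xw (step wy here) , shorter
  where
  shorter : ∀ k → k < 2 → ¬ Walk X _ _ k
  shorter zero          _                here           = x≢y refl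
  shorter (suc zero)    _                (step xy here) = x≁y xy
  shorter (suc (suc k)) (s≤s (s≤s ()))

twoApart? : (X : Graph) (x y : V X) → Dec (TwoApart X x y)
twoApart? X x y =
  ¬? (x ≟ y) ×-dec ¬? (adj X x y ≟ᵇ true)
  ×-dec any? (λ w → (adj X x w ≟ᵇ true) ×-dec (adj X w y ≟ᵇ true))

Collapses : (X : Graph) → (V X → V X) → Set
Collapses X f = IsHom X X f × ∃₂ λ x y → TwoApart X x y × f x ≡ f y

collapsing? : (X : Graph) → Dec (∃ (Collapses X))
collapsing? X = ∃-fun? (Collapses X) respects collapses?
  where
  respects : ∀ {f g} → f ≗ g → Collapses X f → Collapses X g
  respects f≗g (f-hom , x , y , xy , fx≡fy) =
    (λ u v uv → subst₂ (Adj X) (f≗g u) (f≗g v) (f-hom u v uv)) ,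
    x , y , xy , trans (sym (f≗g x)) (trans fx≡fy (f≗g y))

  collapses? : ∀ f → Dec (Collapses X f)
  collapses? f =
    all? (λ u → all? λ v → (adj X u v ≟ᵇ true) →-dec (adj X (f u) (f v) ≟ᵇ true))
    ×-dec any? (λ x → any? λ y → twoApart? X x y ×-dec (f x ≟ f y))

-- Case 1: some endomorphism identifies a two-apart pair; then every core of
-- X is complete.

Collapsible : (X : Graph) → V X → V X → Set
Collapsible X a b = ∃ λ e → IsHom X X e × e a ≡ e b

-- If Aut(X) is transitive on pairs at distance two and one two-apart pair
-- collapses, then all do: precompose the collapse with an automorphism
-- carrying the new pair onto the collapsed one.
collapse-everywhere : (X : Graph) → DistTwoTransitive X → ∃ (Collapses X) →
  ∀ {a b} → TwoApart X a b → Collapsible X a b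
collapse-everywhere X transitive (e , e-hom , x , y , xy , ex≡ey) ab
  with σ , σ-aut , σa≡x , σb≡y ← transitive _ _ x y (twoApart⇒dist2 X ab) (twoApart⇒dist2 X xy) =
  e ∘ σ ,
  (λ u v uv → e-hom _ _ (automorphism⇒hom X σ-aut u v uv)) ,
  trans (cong e σa≡x) (trans ex≡ey (cong e (sym σb≡y)))

walk-closes : (Y : Graph) → (∀ {a b} → ¬ TwoApart Y a b) →
  ∀ {s t k} → Walk Y s t k → s ≡ t ⊎ Adj Y s t
walk-closes Y none here = inj₁ refl
walk-closes Y none {s} {t} (step {w = w} sw wt) with walk-closes Y none wt
... | inj₁ refl = inj₂ sw
... | inj₂ wt-adj with s ≟ t | adj Y s t ≟ᵇ true
...   | yes s≡t | _       = inj₁ s≡t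
...   | no _    | yes st  = inj₂ st
...   | no s≢t  | no s≁t  = ⊥-elim (none (s≢t , s≁t , w , sw , wt-adj))

distinct-adjacent⇒complete : (Y : Graph) → (∀ a b → a ≢ b → Adj Y a b) → IsComplete Y
distinct-adjacent⇒complete Y adjacent =
  n Y , id , (id , (λ b → b , id)) , same-adjacency
  where
  same-adjacency : ∀ a b → adj Y a b ≡ not ⌊ a ≟ b ⌋
  same-adjacency a b with a ≟ b
  ... | yes refl = adj-irrefl Y a
  ... | no a≢b   = adjacent a b a≢b

module CoreOf (X Y : Graph) (core : IsCore Y)
  (h : V X → V Y) (h-hom : IsHom X Y h) (g : V Y → V X) (g-hom : IsHom Y X g) where

  round-trip : IsAutomorphism Y (h ∘ g)
  round-trip = core (h ∘ g) (λ u v uv → h-hom _ _ (g-hom u v uv))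

  round-trip-injective : Injective _≡_ _≡_ (h ∘ g)
  round-trip-injective = proj₁ (proj₁ round-trip)

  round-trip-reflects : ∀ {a b} → Adj Y (h (g a)) (h (g b)) → Adj Y a b
  round-trip-reflects {a} {b} = trans (proj₂ round-trip a b)

  g-twoApart : ∀ {a b} → TwoApart Y a b → TwoApart X (g a) (g b)
  g-twoApart (a≢b , a≁b , c , ac , cb) =
    (λ ga≡gb → a≢b (round-trip-injective (cong h ga≡gb))) ,
    (λ ga~gb → a≁b (round-trip-reflects (h-hom _ _ ga~gb))) ,
    g c , g-hom _ _ ac , g-hom _ _ cb

  -- If every two-apart pair of X collapses, Y has no two-apart pair: a
  -- collapse e of (g a, g b) gives the endomorphism h ∘ e ∘ g of Y
  -- identifying a and b, which must be injective since Y is a core.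
  no-twoApart : (∀ {x y} → TwoApart X x y → Collapsible X x y) →
    ∀ {a b} → ¬ TwoApart Y a b
  no-twoApart collapse {a} {b} ab
    with e , e-hom , e-collapses ← collapse (g-twoApart ab) =
    proj₁ ab (proj₁ (proj₁ (core (h ∘ e ∘ g) ψ-hom)) (cong h e-collapses))
    where
    ψ-hom : IsHom Y Y (h ∘ e ∘ g)
    ψ-hom u v uv = h-hom _ _ (e-hom _ _ (g-hom u v uv))

  -- If moreover X is connected, Y is complete: a walk from g a to g b in X
  -- maps to a walk from h (g a) to h (g b) in Y, whose ends are then equal
  -- or adjacent, and the round trip is injective and reflects adjacency.
  complete : Connected X → (∀ {x y} → TwoApart X x y → Collapsible X x y) → IsComplete Y
  complete connected collapse = distinct-adjacent⇒complete Y adjacent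
    where
    adjacent : ∀ a b → a ≢ b → Adj Y a b
    adjacent a b a≢b
      with walk-closes Y (no-twoApart collapse) (map-walk X Y h-hom (proj₂ (connected (g a) (g b))))
    ... | inj₁ hga≡hgb = contradiction (round-trip-injective hga≡hgb) a≢b
    ... | inj₂ hga~hgb = round-trip-reflects hga~hgb

-- Case 2: no endomorphism identifies a two-apart pair; then every
-- endomorphism of a connected regular X is an automorphism.

LocallyInjective : (X Y : Graph) → (V X → V Y) → Set
LocallyInjective X Y f =
  ∀ {u w₁ w₂} → Adj X u w₁ → Adj X u w₂ → f w₁ ≡ f w₂ → w₁ ≡ w₂

LocallySurjective : (X Y : Graph) → (V X → V Y) → Set
LocallySurjective X Y f = ∀ {u w′} → Adj Y (f u) w′ → ∃ λ w → Adj X u w × f w ≡ w′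

-- A homomorphism identifying no two-apart pair is locally injective: two
-- distinct common neighbours are either adjacent or two apart.
locally-injective : (X Y : Graph) {f : V X → V Y} → IsHom X Y f →
  (∀ {x y} → TwoApart X x y → f x ≢ f y) → LocallyInjective X Y f
locally-injective X Y f-hom separates {u} {w₁} {w₂} uw₁ uw₂ fw₁≡fw₂
  with w₁ ≟ w₂ | adj X w₁ w₂ ≟ᵇ true
... | yes w₁≡w₂ | _      = w₁≡w₂
... | no _      | yes w₁w₂ = contradiction fw₁≡fw₂ (hom-separates X Y f-hom w₁w₂)
... | no w₁≢w₂  | no w₁≁w₂ =
  contradiction fw₁≡fw₂ (separates (w₁≢w₂ , w₁≁w₂ , u , adj-swap X uw₁ , uw₂))

neighbours : (X : Graph) → V X → List (V X)
neighbours X v = filter (λ w → adj X v w ≟ᵇ true) (allFin (n X))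

neighbours-unique : (X : Graph) (v : V X) → Unique (neighbours X v)
neighbours-unique X v = filter⁺ _ (allFin⁺ (n X))

length-neighbours : (X : Graph) (v : V X) → length (neighbours X v) ≡ degree X v
length-neighbours X v = sym (count≡length-filter (adj X v) (allFin (n X)))

∈-neighbours : (X : Graph) {v w : V X} → Adj X v w → w ∈ neighbours X v
∈-neighbours X {v} vw = ∈-filter⁺ (λ w → adj X v w ≟ᵇ true) (∈-allFin _) vw

neighbours-adj : (X : Graph) {v w : V X} → w ∈ neighbours X v → Adj X v w
neighbours-adj X {v} w∈ = proj₂ (∈-filter⁻ (λ w → adj X v w ≟ᵇ true) {xs = allFin (n X)} w∈)

-- A locally injective homomorphism into a graph whose degrees are no larger
-- is locally surjective: otherwise a neighbour w′ of f u outside f[N(u)]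
-- together with f[N(u)] gives degree X u + 1 distinct neighbours of f u.
locally-surjective : (X Y : Graph) {f : V X → V Y} → IsHom X Y f →
  (∀ u → degree Y (f u) ≤ degree X u) → LocallyInjective X Y f → LocallySurjective X Y f
locally-surjective X Y {f} f-hom degree≤ f-inj {u} {w′} fu-w′
  with any? (λ w → (adj X u w ≟ᵇ true) ×-dec (f w ≟ w′))
... | yes hit = hit
... | no miss = contradiction (≤-trans too-many (degree≤ u)) 1+n≰n
  where
  image : List (V Y)
  image = map f (neighbours X u)

  image-unique : Unique image
  image-unique = unique-map f
    (λ a∈ b∈ → f-inj (neighbours-adj X a∈) (neighbours-adj X b∈))
    (neighbours-unique X u)

  w′∉image : ¬ w′ ∈ image
  w′∉image w′∈ with w , w∈ , w′≡fw ← ∈-map⁻ f w′∈ =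
    miss (w , neighbours-adj X w∈ , sym w′≡fw)

  w′∷image-unique : Unique (w′ ∷ image)
  w′∷image-unique =
    All.tabulate (λ y∈ w′≡y → w′∉image (subst (_∈ image) (sym w′≡y) y∈)) ∷ image-unique

  all-adjacent : (w′ ∷ image) ⊆ neighbours Y (f u)
  all-adjacent (here refl) = ∈-neighbours Y fu-w′
  all-adjacent (there fw∈) with w , w∈ , refl ← ∈-map⁻ f fw∈ =
    ∈-neighbours Y (f-hom _ _ (neighbours-adj X w∈))

  too-many : suc (degree X u) ≤ degree Y (f u)
  too-many = begin
    suc (degree X u)                   ≡⟨ cong suc (sym (length-neighbours X u)) ⟩
    suc (length (neighbours X u))      ≡⟨ cong suc (sym (length-map f (neighbours X u))) ⟩
    length (w′ ∷ image)                ≤⟨ unique-⊆⇒length≤ w′∷image-unique all-adjacent ⟩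
    length (neighbours Y (f u))        ≡⟨ length-neighbours Y (f u) ⟩
    degree Y (f u)                     ∎
    where open ≤-Reasoning

-- Walks lift along locally surjective maps, so the image of f contains
-- every vertex reachable from an image vertex.
image-closed : (X Y : Graph) {f : V X → V Y} → LocallySurjective X Y f →
  ∀ {u t k} → Walk Y (f u) t k → ∃ λ v → f v ≡ t
image-closed X Y lift {u} here = u , refl
image-closed X Y lift (step fu-w rest) with v , _ , refl ← lift fu-w =
  image-closed X Y lift rest

-- A locally surjective endomorphism of a connected graph is an automorphism:
-- it is onto by lifting walks, hence injective on the finite vertex set, and
-- it reflects adjacency, because a lifted neighbour of u mapping to f v must
-- be v itself.
locally-surjective⇒automorphism : (X : Graph) {f : V X → V X} → Connected X →
  IsHom X X f → LocallySurjective X X f → IsAutomorphism X f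
locally-surjective⇒automorphism X {f} connected f-hom lift =
  (f-injective , strictlySurjective⇒surjective f-onto) , same-adjacency
  where
  f-onto : StrictlySurjective _≡_ f
  f-onto t = image-closed X X lift (proj₂ (connected (f t) t))

  f-injective : Injective _≡_ _≡_ f
  f-injective = onto⇒injective f-onto

  reflects : ∀ {u v} → Adj X (f u) (f v) → Adj X u v
  reflects fu-fv with w , uw , fw≡fv ← lift fu-fv = subst (Adj X _) (f-injective fw≡fv) uw

  same-adjacency : ∀ u v → adj X u v ≡ adj X (f u) (f v)
  same-adjacency u v = ⇔→≡ (mk⇔ (f-hom u v) reflects)

mainTheorem5 : (X : Graph) → Connected X → Regular X → DistTwoTransitive X →
    IsCore X ⊎ CoreIsComplete X
mainTheorem5 X connected (k , degree≡k) transitive with collapsing? X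
... | yes collapse =
  inj₂ λ Y core ((h , h-hom) , (g , g-hom)) →
    CoreOf.complete X Y core h h-hom g g-hom connected (collapse-everywhere X transitive collapse)
... | no no-collapse = inj₁ λ f f-hom →
  let separates : ∀ {x y} → TwoApart X x y → f x ≢ f y
      separates xy fx≡fy = no-collapse (f , f-hom , _ , _ , xy , fx≡fy)
      degree≤ : ∀ u → degree X (f u) ≤ degree X u
      degree≤ u = ≤-reflexive (trans (degree≡k (f u)) (sym (degree≡k u)))
  in locally-surjective⇒automorphism X connected f-hom
       (locally-surjective X X f-hom degree≤ (locally-injective X X f-hom separates))
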